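{- Let $1 \le r \le n$. The set of all loopfree nested matroids of rank $r$ on the ground set $[n]=\{1,\dots,n\}$ is linearly independent in the $\mathbb{Z}$-module $\mathbb{M}_{r,n}$.
   Context: Matroids are on the labeled ground set $E=[n]$ (not up to isomorphism). For $1\le r\le n$ let $\mathfrak{C}_{r,n}$ be the set of chains of sets $\emptyset \subsetneq F_1 \subsetneq \dots \subsetneq F_r = E$, and $V_{r,n}=\mathbb{Z}^{\mathfrak{C}_{r,n}}$. Let $\mathbb{M}^{\mathrm{free}}_{r,n}$ be the free $\mathbb{Z}$-module on all loopfree matroids of rank $r$ on $[n]$, and $\Phi_{r,n}:\mathbb{M}^{\mathrm{free}}_{r,n}\to V_{r,n}$ the homomorphism sending $M$ to its indicator vector $v_M$, where $(v_M)_{\mathcal{C}}=1$ if the chain $\mathcal{C}$ consists of flats of $M$ and $0$ otherwise. Then $\mathbb{M}_{r,n}:=\mathbb{M}^{\mathrm{free}}_{r,n}/\ker\Phi_{r,n}$ (equivalently, the submodule of $V_{r,n}$ spanned by the vectors $v_M$). A flat of $M$ is cyclic if it is a union of circuits; $M$ is nested if its set of cyclic flats is totally ordered by inclusion. -}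

module Defs where

open import Data.Bool using (Bool; true; false; if_then_else_; _∧_; _∨_; not)
open import Data.Nat using (ℕ; zero; suc; _<_; _≤_; _⊔_; _<ᵇ_)
open import Data.Fin using (Fin; toℕ)
open import Data.Fin.Subset
  using (Subset; _∈_; _∉_; _⊆_; _⊂_; _∪_; _-_; ⁅_⁆; ⊤; ⊥; ∣_∣; Nonempty; inside; outside)
open import Data.Vec using (Vec; []; _∷_; lookup)
open import Data.List using (List; []; _∷_; _++_; map; foldr; filter; allFin)
open import Data.Bool.ListAction using (and; all)
open import Data.Integer using (ℤ; 0ℤ; 1ℤ; _+_; _*_)
open import Data.Product using (Σ; ∃; _×_)
open import Data.Sum using (_⊎_)
open import Relation.Binary.PropositionalEquality using (_≡_)
open import Relation.Nullary using (¬_)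

allSubsets : (n : ℕ) → List (Subset n)
allSubsets zero = [] ∷ []
allSubsets (suc n) = map (outside ∷_) (allSubsets n) ++ map (inside ∷_) (allSubsets n)

_⊆ᵇ_ : {n : ℕ} → Subset n → Subset n → Bool
_⊆ᵇ_ {n} A B = all (λ x → not (lookup A x) ∨ lookup B x) (allFin n)

record Matroid (n : ℕ) : Set where
  field
    indep : Subset n → Bool
    indep-empty : indep ⊥ ≡ true
    indep-down : ∀ A B → B ⊆ A → indep A ≡ true → indep B ≡ true
    indep-aug : ∀ A B → indep A ≡ true → indep B ≡ true → ∣ A ∣ < ∣ B ∣ →
                ∃ λ x → x ∈ B × x ∉ A × indep (A ∪ ⁅ x ⁆) ≡ true
open Matroid public

rk : {n : ℕ} → Matroid n → Subset n → ℕ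
rk {n} M A =
  foldr _⊔_ 0 (map ∣_∣ (filter (λ I → Data.Bool._≟_ (I ⊆ᵇ A ∧ indep M I) true) (allSubsets n)))
  where import Data.Bool

rank : {n : ℕ} → Matroid n → ℕ
rank {n} M = rk M ⊤

isFlat : {n : ℕ} → Matroid n → Subset n → Bool
isFlat {n} M F = all (λ x → lookup F x ∨ (rk M F <ᵇ rk M (F ∪ ⁅ x ⁆))) (allFin n)

Flat : {n : ℕ} → Matroid n → Subset n → Set
Flat M F = isFlat M F ≡ true

Circuit : {n : ℕ} → Matroid n → Subset n → Set
Circuit M C = indep M C ≡ false × (∀ x → x ∈ C → indep M (C - x) ≡ true)

Cyclic : {n : ℕ} → Matroid n → Subset n → Set
Cyclic {n} M F = ∀ x → x ∈ F → ∃ λ C → Circuit M C × C ⊆ F × x ∈ C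

CyclicFlat : {n : ℕ} → Matroid n → Subset n → Set
CyclicFlat M F = Flat M F × Cyclic M F

Nested : {n : ℕ} → Matroid n → Set
Nested M = ∀ F G → CyclicFlat M F → CyclicFlat M G → F ⊆ G ⊎ G ⊆ F

Loopfree : {n : ℕ} → Matroid n → Set
Loopfree {n} M = ∀ (x : Fin n) → indep M ⁅ x ⁆ ≡ true

-- Chains ∅ ⊊ F₁ ⊊ ... ⊊ F_r = E, indexed by Fin r (index i stands for F_{i+1}).
record Chain (r n : ℕ) : Set where
  field
    set : Fin r → Subset n
    first-nonempty : ∀ i → toℕ i ≡ 0 → Nonempty (set i)
    strict : ∀ i j → toℕ j ≡ suc (toℕ i) → set i ⊂ set j
    last-top : ∀ i → suc (toℕ i) ≡ r → set i ≡ ⊤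
open Chain public

-- Indicator vector v_M ∈ V_{r,n} = ℤ^{chains}: 1 if the chain consists of flats of M.
v : {r n : ℕ} → Matroid n → Chain r n → ℤ
v {r} M C = if and (map (λ i → isFlat M (set C i)) (allFin r)) then 1ℤ else 0ℤ

∑ : {k : ℕ} → (Fin k → ℤ) → ℤ
∑ {zero} f = 0ℤ
∑ {suc k} f = f Fin.zero + ∑ (λ i → f (Fin.suc i))
  where import Data.Fin as Fin

SameMatroid : {n : ℕ} → Matroid n → Matroid n → Set
SameMatroid {n} M N = ∀ (A : Subset n) → indep M A ≡ indep N A

LoopfreeNestedRank : (r n : ℕ) → Matroid n → Set
LoopfreeNestedRank r n M = Loopfree M × Nested M × rank M ≡ r

module Submission where

-- For a loopfree nested matroid M of rank r we build a maximal chain of flats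
-- C_M = (F₁ ⊊ ⋯ ⊊ F_r = E) with rk_M F_k = k that is comparable with every
-- cyclic flat of M; consequently every circuit D of M lies in F_{rk D}.  If the
-- members of C_M are also flats of a matroid N of rank r, then rk_N F_k ≤ k,
-- so each circuit D ⊆ F_{rk D} (which has rk D + 1 elements) is N-dependent:
-- every N-independent set is M-independent.  Hence v_N(C_M) ≠ 0 together with
-- N ≠ M forces N to have strictly fewer independent sets than M, while
-- v_M(C_M) = 1.  The vectors v_M are thus unitriangular with respect to the
-- number of independent sets, and an abstract triangularity lemma finishes.

open import Defs
open import Data.Nat using (ℕ; _≤_)
open import Data.Fin using (Fin)
open import Data.Integer using (ℤ; 0ℤ; _*_)
open import Relation.Binary.PropositionalEquality using (_≡_; _≢_)
open import Relation.Nullary using (¬_)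

open import Data.Bool using (Bool; true; false; not; _∧_; _∨_; T; if_then_else_)
open import Data.Bool.ListAction using (and; all)
open import Data.Bool.Properties using (T-≡)
import Data.Bool.Properties as Bool
open import Data.Nat using (zero; suc; _<_; _⊔_; _<ᵇ_; _+_; _∸_; s≤s; _≤?_; _<?_)
open import Data.Nat.Properties
  using ( ≤-refl; ≤-reflexive; ≤-trans; ≤-antisym; <-≤-trans; ≤-pred; 1+n≰n
        ; <⇒≱; ≮⇒≥; ≰⇒>; <⇒≤; m≤n⇒m≤1+n; m≤m⊔n; m≤n⊔m; ⊔-sel; ⊔-identityʳ; m≤n+m; +-suc
        ; m∸n+n≡m; m+[n∸m]≡n; +-cancelʳ-≤; +-monoˡ-≤; <ᵇ⇒<; <⇒<ᵇ; n≤0⇒n≡0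
        ; +-identityʳ; m≤m+n; module ≤-Reasoning )
open import Data.Nat.Induction using (<-wellFounded)
open import Data.Fin using (zero; suc; toℕ; fromℕ<)
open import Data.Fin.Properties using (toℕ<n; toℕ-fromℕ<; any?; all?; suc-injective)
open import Data.Fin.Subset using (Subset; _∈_; _∉_; _⊆_; _⊂_; _∪_; _-_; ⁅_⁆; ⊤; ⊥; ∣_∣; inside; outside; Nonempty)
open import Data.Fin.Subset.Properties
  using ( _∈?_; _⊆?_; ⊆-refl; ⊆-trans; ⊆-antisym; ⊥⊆; ⊆⊤; ∣⊥∣≡0; x∈⁅x⁆; x∈⁅y⁆⇒x≡y; ∣⁅x⁆∣≡1
        ; p⊆p∪q; q⊆p∪q; x∈p∪q⁻; ∪-identityʳ; p─⊥≡p; p─q⊆p; x∈p∧x≢y⇒x∈p-y; x∈p⇒∣p-x∣<∣p∣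
        ; p⊆q⇒∣p∣≤∣q∣; p⊂q⇒∣p∣<∣q∣; nonempty?; anySubset? )
open import Data.Vec using ([]; _∷_; here; there; lookup; tabulate)
open import Data.Vec.Properties using ([]=⇒lookup; lookup⇒[]=; lookup∘tabulate)
open import Data.List using (List; []; _∷_; map; foldr; filter; allFin)
open import Data.List.Relation.Unary.Any using (here; there)
import Data.List.Relation.Unary.All as All
open import Data.List.Relation.Unary.All.Properties using (all⁺; all⁻)
open import Data.List.Membership.Propositional using () renaming (_∈_ to _∈ˡ_)
open import Data.List.Membership.Propositional.Properties
  using (∈-allFin; ∈-map⁺; ∈-map⁻; ∈-filter⁺; ∈-filter⁻; ∈-++⁺ˡ; ∈-++⁺ʳ)
open import Data.List.Extrema.Nat using (argmin; argmin-all; f[argmin]≤f[⊤]; f[argmin]≤f[xs])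
open import Data.Integer using (1ℤ)
import Data.Integer as Int
open import Data.Integer.Properties using (*-identityʳ; *-zeroˡ; *-zeroʳ)
import Data.Integer.Properties as Intₚ
open import Data.Product using (∃; _×_; _,_; proj₁; proj₂)
open import Data.Sum using (_⊎_; inj₁; inj₂; map₂)
open import Data.Empty using (⊥-elim)
open import Function using (_∘_; Equivalence)
open import Induction.WellFounded using (Acc; acc)
open import Relation.Binary.PropositionalEquality using (refl; sym; trans; cong; cong₂; subst; module ≡-Reasoning)
open import Relation.Nullary using (Dec; yes; no; contradiction; ¬?; _×-dec_; _→-dec_)
open import Relation.Nullary.Decidable using (does; dec-true; decidable-stable)

T⇒≡ : ∀ {b} → T b → b ≡ true
T⇒≡ = Equivalence.to T-≡

≡⇒T : ∀ {b} → b ≡ true → T b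
≡⇒T = Equivalence.from T-≡

∧≡true : ∀ {a b} → a ∧ b ≡ true → a ≡ true × b ≡ true
∧≡true {true} {true} _ = refl , refl
∧≡true {true} {false} ()
∧≡true {false} ()

does⇒ : ∀ {P : Set} (P? : Dec P) → does P? ≡ true → P
does⇒ (yes p) _ = p
does⇒ (no _) ()

all-allFin⁺ : ∀ {n} (f : Fin n → Bool) → (∀ x → f x ≡ true) → all f (allFin n) ≡ true
all-allFin⁺ {n} f holds = T⇒≡ (all⁻ f {xs = allFin n} (All.tabulate λ {x} _ → ≡⇒T (holds x)))

all-allFin⁻ : ∀ {n} (f : Fin n → Bool) → all f (allFin n) ≡ true → ∀ x → f x ≡ true
all-allFin⁻ {n} f holds x = T⇒≡ (All.lookup (all⁺ f (allFin n) (≡⇒T holds)) (∈-allFin x))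

lookup⇒∈ : ∀ {n} {p : Subset n} {x} → lookup p x ≡ true → x ∈ p
lookup⇒∈ {p = p} {x} = lookup⇒[]= x p

∉⇒lookup : ∀ {n} {p : Subset n} {x} → x ∉ p → lookup p x ≡ false
∉⇒lookup {p = p} {x} x∉p with lookup p x in entry
... | true = contradiction (lookup⇒∈ entry) x∉p
... | false = refl

⊆ᵇ⇒⊆ : ∀ {n} {A B : Subset n} → A ⊆ᵇ B ≡ true → A ⊆ B
⊆ᵇ⇒⊆ {A = A} {B} A⊆ᵇB {x} x∈A =
  lookup⇒∈ (subst (λ b → not b ∨ lookup B x ≡ true) ([]=⇒lookup x∈A) (all-allFin⁻ _ A⊆ᵇB x))

⊆⇒⊆ᵇ : ∀ {n} {A B : Subset n} → A ⊆ B → A ⊆ᵇ B ≡ true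
⊆⇒⊆ᵇ {A = A} {B} A⊆B = all-allFin⁺ _ λ x → entrywise x (lookup A x) refl
  where
  entrywise : ∀ x b → lookup A x ≡ b → not b ∨ lookup B x ≡ true
  entrywise x true  Ax = []=⇒lookup (A⊆B (lookup⇒∈ Ax))
  entrywise x false _  = refl

allSubsets-complete : ∀ {n} (p : Subset n) → p ∈ˡ allSubsets n
allSubsets-complete [] = here refl
allSubsets-complete {suc n} (outside ∷ p) = ∈-++⁺ˡ (∈-map⁺ (outside ∷_) (allSubsets-complete p))
allSubsets-complete {suc n} (inside ∷ p) =
  ∈-++⁺ʳ (map (outside ∷_) (allSubsets n)) (∈-map⁺ (inside ∷_) (allSubsets-complete p))

max-bound : ∀ {x} (xs : List ℕ) → x ∈ˡ xs → x ≤ foldr _⊔_ 0 xs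
max-bound (y ∷ xs) (here refl) = m≤m⊔n y _
max-bound (y ∷ xs) (there x∈xs) = ≤-trans (max-bound xs x∈xs) (m≤n⊔m y _)

max-attained : (xs : List ℕ) → foldr _⊔_ 0 xs ≡ 0 ⊎ foldr _⊔_ 0 xs ∈ˡ xs
max-attained [] = inj₁ refl
max-attained (y ∷ xs) with ⊔-sel y (foldr _⊔_ 0 xs) | max-attained xs
... | inj₁ max≡y | _ = inj₂ (here max≡y)
... | inj₂ max≡rest | inj₂ rest∈xs = inj₂ (there (subst (_∈ˡ xs) (sym max≡rest) rest∈xs))
... | inj₂ _ | inj₁ rest≡0 = inj₂ (here (trans (cong (y ⊔_) rest≡0) (⊔-identityʳ y)))

⊈-witness : ∀ {n} {p q : Subset n} → ¬ (p ⊆ q) → ∃ λ x → x ∈ p × x ∉ q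
⊈-witness {p = p} {q} p⊈q with any? (λ x → x ∈? p ×-dec ¬? (x ∈? q))
... | yes witness = witness
... | no none = contradiction (λ {x} x∈p → decidable-stable (x ∈? q) λ x∉q → none (x , x∈p , x∉q)) p⊈q

⊆-by-size : ∀ {n} {p q : Subset n} → q ⊆ p → ∣ p ∣ ≤ ∣ q ∣ → p ⊆ q
⊆-by-size {q = q} q⊆p ∣p∣≤∣q∣ {x} x∈p =
  decidable-stable (x ∈? q) λ x∉q → <⇒≱ (p⊂q⇒∣p∣<∣q∣ (q⊆p , x , x∈p , x∉q)) ∣p∣≤∣q∣

x∈p∪⁅x⁆ : ∀ {n} (p : Subset n) x → x ∈ p ∪ ⁅ x ⁆
x∈p∪⁅x⁆ p x = q⊆p∪q p ⁅ x ⁆ (x∈⁅x⁆ x)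

p⊆p∪⁅x⁆ : ∀ {n} (p : Subset n) x → p ⊆ p ∪ ⁅ x ⁆
p⊆p∪⁅x⁆ p x = p⊆p∪q ⁅ x ⁆

∈p∪⁅x⁆⁻ : ∀ {n} {p : Subset n} {x y} → y ∈ p ∪ ⁅ x ⁆ → y ∈ p ⊎ y ≡ x
∈p∪⁅x⁆⁻ {p = p} {x} y∈ with x∈p∪q⁻ p ⁅ x ⁆ y∈
... | inj₁ y∈p = inj₁ y∈p
... | inj₂ y∈⁅x⁆ = inj₂ (x∈⁅y⁆⇒x≡y x y∈⁅x⁆)

∪⁅⁆-⊆ : ∀ {n} {p q : Subset n} {x} → p ⊆ q → x ∈ q → p ∪ ⁅ x ⁆ ⊆ q
∪⁅⁆-⊆ p⊆q x∈q y∈ with ∈p∪⁅x⁆⁻ y∈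
... | inj₁ y∈p = p⊆q y∈p
... | inj₂ refl = x∈q

∪⁅⁆-mono : ∀ {n} {p q : Subset n} {x} → p ⊆ q → p ∪ ⁅ x ⁆ ⊆ q ∪ ⁅ x ⁆
∪⁅⁆-mono {q = q} {x} p⊆q = ∪⁅⁆-⊆ (⊆-trans p⊆q (p⊆p∪⁅x⁆ q x)) (x∈p∪⁅x⁆ q x)

x∈p⇒⁅x⁆⊆p : ∀ {n} {p : Subset n} {x} → x ∈ p → ⁅ x ⁆ ⊆ p
x∈p⇒⁅x⁆⊆p {p = p} {x} x∈p y∈⁅x⁆ = subst (_∈ p) (sym (x∈⁅y⁆⇒x≡y x y∈⁅x⁆)) x∈p

x∉p-x : ∀ {n} (p : Subset n) x → x ∉ p - x
x∉p-x (_ ∷ p) zero ()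
x∉p-x (_ ∷ p) (suc x) (there x∈p-x) = x∉p-x p x x∈p-x

x∉p⇒∣p∪⁅x⁆∣≡1+∣p∣ : ∀ {n} (p : Subset n) {x} → x ∉ p → ∣ p ∪ ⁅ x ⁆ ∣ ≡ suc ∣ p ∣
x∉p⇒∣p∪⁅x⁆∣≡1+∣p∣ (outside ∷ p) {zero} _ = cong suc (cong ∣_∣ (∪-identityʳ p))
x∉p⇒∣p∪⁅x⁆∣≡1+∣p∣ (inside ∷ p) {zero} x∉p = contradiction here x∉p
x∉p⇒∣p∪⁅x⁆∣≡1+∣p∣ (outside ∷ p) {suc x} x∉p = x∉p⇒∣p∪⁅x⁆∣≡1+∣p∣ p (x∉p ∘ there)
x∉p⇒∣p∪⁅x⁆∣≡1+∣p∣ (inside ∷ p) {suc x} x∉p = cong suc (x∉p⇒∣p∪⁅x⁆∣≡1+∣p∣ p (x∉p ∘ there))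

x∈p⇒∣p∣≡1+∣p-x∣ : ∀ {n} {p : Subset n} {x} → x ∈ p → ∣ p ∣ ≡ suc ∣ p - x ∣
x∈p⇒∣p∣≡1+∣p-x∣ {p = inside ∷ p} here = cong suc (cong ∣_∣ (sym (p─⊥≡p p)))
x∈p⇒∣p∣≡1+∣p-x∣ {p = inside ∷ p} (there x∈p) = cong suc (x∈p⇒∣p∣≡1+∣p-x∣ x∈p)
x∈p⇒∣p∣≡1+∣p-x∣ {p = outside ∷ p} (there x∈p) = x∈p⇒∣p∣≡1+∣p-x∣ x∈p

∣p∣≤1+∣p-x∣ : ∀ {n} (p : Subset n) x → ∣ p ∣ ≤ suc ∣ p - x ∣
∣p∣≤1+∣p-x∣ p x with x ∈? p
... | yes x∈p = ≤-reflexive (x∈p⇒∣p∣≡1+∣p-x∣ x∈p)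
... | no x∉p = m≤n⇒m≤1+n (p⊆q⇒∣p∣≤∣q∣ {p = p} {q = p - x} λ y∈p → x∈p∧x≢y⇒x∈p-y y∈p λ { refl → x∉p y∈p })

module MatroidTheory {n : ℕ} (M : Matroid n) where

  Independent : Subset n → Set
  Independent A = indep M A ≡ true

  Dependent : Subset n → Set
  Dependent A = indep M A ≡ false

  independent? : ∀ A → Independent A ⊎ Dependent A
  independent? A with indep M A
  ... | true = inj₁ refl
  ... | false = inj₂ refl

  independent⇒¬dependent : ∀ {A} → Independent A → ¬ Dependent A
  independent⇒¬dependent A-ind A-dep = contradiction (trans (sym A-ind) A-dep) λ ()

  independent-⊆ : ∀ {I J} → Independent I → J ⊆ I → Independent J
  independent-⊆ {I} {J} I-ind J⊆I = indep-down M I J J⊆I I-ind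

  Basis : Subset n → Subset n → Set
  Basis A I = Independent I × I ⊆ A × ∣ I ∣ ≡ rk M A

  admissible? : ∀ A J → Dec ((J ⊆ᵇ A ∧ indep M J) ≡ true)
  admissible? A J = (J ⊆ᵇ A ∧ indep M J) Bool.≟ true

  independent⇒≤rk : ∀ {I A} → Independent I → I ⊆ A → ∣ I ∣ ≤ rk M A
  independent⇒≤rk {I} {A} I-ind I⊆A =
    max-bound _ (∈-map⁺ ∣_∣ (∈-filter⁺ (admissible? A) (allSubsets-complete I) admissible))
    where
    admissible : (I ⊆ᵇ A ∧ indep M I) ≡ true
    admissible rewrite ⊆⇒⊆ᵇ I⊆A | I-ind = refl

  basis : ∀ A → ∃ (Basis A)
  basis A with max-attained (map ∣_∣ (filter (admissible? A) (allSubsets n)))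
  ... | inj₁ rk≡0 = ⊥ , indep-empty M , ⊥⊆ , trans (∣⊥∣≡0 n) (sym rk≡0)
  ... | inj₂ rk∈sizes with ∈-map⁻ ∣_∣ rk∈sizes
  ...   | I , I∈admissible , rk≡∣I∣ with ∧≡true (proj₂ (∈-filter⁻ (admissible? A) {xs = allSubsets n} I∈admissible))
  ...     | I⊆ᵇA , I-ind = I , I-ind , ⊆ᵇ⇒⊆ I⊆ᵇA , sym rk≡∣I∣

  rk-mono : ∀ {A B} → A ⊆ B → rk M A ≤ rk M B
  rk-mono {A} A⊆B with basis A
  ... | I , I-ind , I⊆A , ∣I∣≡rk = subst (_≤ _) ∣I∣≡rk (independent⇒≤rk I-ind (⊆-trans I⊆A A⊆B))

  rk≤∣∣ : ∀ A → rk M A ≤ ∣ A ∣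
  rk≤∣∣ A with basis A
  ... | I , _ , I⊆A , ∣I∣≡rk = subst (_≤ ∣ A ∣) ∣I∣≡rk (p⊆q⇒∣p∣≤∣q∣ I⊆A)

  rk-∪⁅⁆ : ∀ A x → rk M (A ∪ ⁅ x ⁆) ≤ suc (rk M A)
  rk-∪⁅⁆ A x with basis (A ∪ ⁅ x ⁆)
  ... | I , I-ind , I⊆A∪x , ∣I∣≡rk = subst (_≤ _) ∣I∣≡rk (≤-trans (∣p∣≤1+∣p-x∣ I x) (s≤s ∣I-x∣≤rkA))
    where
    I-x⊆A : I - x ⊆ A
    I-x⊆A {y} y∈I-x with ∈p∪⁅x⁆⁻ (I⊆A∪x (p─q⊆p I ⁅ x ⁆ y∈I-x))
    ... | inj₁ y∈A = y∈A
    ... | inj₂ refl = contradiction y∈I-x (x∉p-x I x)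
    ∣I-x∣≤rkA : ∣ I - x ∣ ≤ rk M A
    ∣I-x∣≤rkA = independent⇒≤rk (independent-⊆ I-ind (p─q⊆p I ⁅ x ⁆)) I-x⊆A

  augment : ∀ {I A} → Independent I → I ⊆ A → ∣ I ∣ < rk M A →
            ∃ λ x → x ∈ A × x ∉ I × Independent (I ∪ ⁅ x ⁆)
  augment {I} {A} I-ind I⊆A ∣I∣<rk with basis A
  ... | J , J-ind , J⊆A , ∣J∣≡rk with indep-aug M I J I-ind J-ind (subst (∣ I ∣ <_) (sym ∣J∣≡rk) ∣I∣<rk)
  ...   | x , x∈J , x∉I , I∪x-ind = x , J⊆A x∈J , x∉I , I∪x-ind

  extend-to-basis : ∀ {I B} → Independent I → I ⊆ B → ∃ λ J → Basis B J × I ⊆ J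
  extend-to-basis {I} {B} I-ind I⊆B =
    extend (rk M B ∸ ∣ I ∣) I-ind I⊆B (sym (m∸n+n≡m (independent⇒≤rk I-ind I⊆B)))
    where
    extend : ∀ d {I} → Independent I → I ⊆ B → rk M B ≡ d + ∣ I ∣ → ∃ λ J → Basis B J × I ⊆ J
    extend zero I-ind I⊆B rk≡ = _ , (I-ind , I⊆B , sym rk≡) , ⊆-refl
    extend (suc d) {I} I-ind I⊆B rk≡ with augment I-ind I⊆B (subst (∣ I ∣ <_) (sym rk≡) (s≤s (m≤n+m ∣ I ∣ d)))
    ... | x , x∈B , x∉I , I∪x-ind with extend d I∪x-ind (∪⁅⁆-⊆ I⊆B x∈B) rk≡'
      where
      rk≡' : rk M B ≡ d + ∣ I ∪ ⁅ x ⁆ ∣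
      rk≡' = trans rk≡ (trans (sym (+-suc d ∣ I ∣)) (cong (d +_) (sym (x∉p⇒∣p∪⁅x⁆∣≡1+∣p∣ I x∉I))))
    ...   | J , J-basis , I∪x⊆J = J , J-basis , ⊆-trans (p⊆p∪⁅x⁆ I x) I∪x⊆J

  basis-maximal : ∀ {B J y} → Basis B J → y ∈ B → y ∉ J → ¬ Independent (J ∪ ⁅ y ⁆)
  basis-maximal {J = J} (_ , J⊆B , ∣J∣≡rk) y∈B y∉J J∪y-ind =
    1+n≰n (subst (λ m → m ≤ _) (trans (x∉p⇒∣p∪⁅x⁆∣≡1+∣p∣ J y∉J) (cong suc ∣J∣≡rk))
                   (independent⇒≤rk J∪y-ind (∪⁅⁆-⊆ J⊆B y∈B)))

  dependent⇒rk<∣∣ : ∀ {A} → Dependent A → rk M A < ∣ A ∣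
  dependent⇒rk<∣∣ {A} A-dep with basis A
  ... | I , I-ind , I⊆A , ∣I∣≡rk with A ⊆? I
  ...   | yes A⊆I = ⊥-elim (independent⇒¬dependent (independent-⊆ I-ind A⊆I) A-dep)
  ...   | no A⊈I = subst (_< ∣ A ∣) ∣I∣≡rk (p⊂q⇒∣p∣<∣q∣ (I⊆A , ⊈-witness A⊈I))

  cl : Subset n → Subset n
  cl A = tabulate (closure-test A)
    where
    closure-test : Subset n → Fin n → Bool
    closure-test A x = does (rk M (A ∪ ⁅ x ⁆) ≤? rk M A)

  ∈cl⁻ : ∀ {A x} → x ∈ cl A → rk M (A ∪ ⁅ x ⁆) ≤ rk M A
  ∈cl⁻ {A} {x} x∈clA = does⇒ (rk M (A ∪ ⁅ x ⁆) ≤? rk M A) (trans (sym (lookup∘tabulate _ x)) ([]=⇒lookup x∈clA))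

  ∈cl⁺ : ∀ {A x} → rk M (A ∪ ⁅ x ⁆) ≤ rk M A → x ∈ cl A
  ∈cl⁺ {A} {x} rk≤ = lookup⇒∈ (trans (lookup∘tabulate _ x) (dec-true (_ ≤? _) rk≤))

  ⊆cl : ∀ A → A ⊆ cl A
  ⊆cl A {x} x∈A = ∈cl⁺ {A} (rk-mono (∪⁅⁆-⊆ {p = A} ⊆-refl x∈A))

  F⊆cl[F∪x] : ∀ F x → F ⊆ cl (F ∪ ⁅ x ⁆)
  F⊆cl[F∪x] F x = ⊆-trans (p⊆p∪⁅x⁆ F x) (⊆cl (F ∪ ⁅ x ⁆))

  basis-∪-cl : ∀ {A I x} → Basis A I → x ∈ cl A → Basis (A ∪ ⁅ x ⁆) I
  basis-∪-cl {A} {x = x} (I-ind , I⊆A , ∣I∣≡rk) x∈clA =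
    I-ind , ⊆-trans I⊆A (p⊆p∪⁅x⁆ A x) , trans ∣I∣≡rk (≤-antisym (rk-mono (p⊆p∪⁅x⁆ A x)) (∈cl⁻ {A} x∈clA))

  -- Closing does not change the rank: an element of cl A cannot augment a basis of A.
  rk-cl : ∀ A → rk M (cl A) ≡ rk M A
  rk-cl A = ≤-antisym (≮⇒≥ rank-cannot-grow) (rk-mono (⊆cl A))
    where
    rank-cannot-grow : ¬ (rk M A < rk M (cl A))
    rank-cannot-grow rk< with basis A
    ... | I , I-basis@(I-ind , I⊆A , ∣I∣≡rk)
        with augment I-ind (⊆-trans I⊆A (⊆cl A)) (subst (_< rk M (cl A)) (sym ∣I∣≡rk) rk<)
    ...   | x , x∈clA , x∉I , I∪x-ind =
      basis-maximal (basis-∪-cl I-basis x∈clA) (x∈p∪⁅x⁆ A x) x∉I I∪x-ind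

  flat⇒rank-jump : ∀ {F x} → Flat M F → x ∉ F → rk M F < rk M (F ∪ ⁅ x ⁆)
  flat⇒rank-jump {F} {x} F-flat x∉F = <ᵇ⇒< _ _ (≡⇒T (subst (λ b → b ∨ (rk M F <ᵇ rk M (F ∪ ⁅ x ⁆)) ≡ true)
    (∉⇒lookup x∉F) (all-allFin⁻ _ F-flat x)))

  rank-jump⇒flat : ∀ {F} → (∀ x → x ∉ F → rk M F < rk M (F ∪ ⁅ x ⁆)) → Flat M F
  rank-jump⇒flat {F} jump = all-allFin⁺ _ member-or-jump
    where
    member-or-jump : ∀ x → lookup F x ∨ (rk M F <ᵇ rk M (F ∪ ⁅ x ⁆)) ≡ true
    member-or-jump x with lookup F x in entry
    ... | true = refl
    ... | false = T⇒≡ (<⇒<ᵇ (jump x λ x∈F → contradiction (trans (sym ([]=⇒lookup x∈F)) entry) λ ()))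

  cl-flat : ∀ A → Flat M (cl A)
  cl-flat A = rank-jump⇒flat {cl A} λ x x∉clA → begin-strict
    rk M (cl A)              ≡⟨ rk-cl A ⟩
    rk M A                   <⟨ ≰⇒> (x∉clA ∘ ∈cl⁺ {A}) ⟩
    rk M (A ∪ ⁅ x ⁆)         ≤⟨ rk-mono (∪⁅⁆-mono {x = x} (⊆cl A)) ⟩
    rk M (cl A ∪ ⁅ x ⁆)      ∎
    where open ≤-Reasoning

  -- For x ∈ cl A outside a flat F ⊇ A,
  -- extend a basis I of A to a basis J of F and augment J inside F ∪ {x}: the
  -- new element cannot lie in F (J is a basis of F), and it cannot be x (I is
  -- still a basis of A ∪ {x}).
  cl-least : ∀ {A F} → Flat M F → A ⊆ F → cl A ⊆ F
  cl-least {A} {F} F-flat A⊆F {x} x∈clA with x ∈? F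
  ... | yes x∈F = x∈F
  ... | no x∉F with basis A
  ...   | I , I-basis@(I-ind , I⊆A , _) with extend-to-basis I-ind (⊆-trans I⊆A A⊆F)
  ...     | J , J-basis@(J-ind , J⊆F , ∣J∣≡rk) , I⊆J
          with augment J-ind (⊆-trans J⊆F (p⊆p∪⁅x⁆ F x)) (subst (_< _) (sym ∣J∣≡rk) (flat⇒rank-jump F-flat x∉F))
  ...       | y , y∈F∪x , y∉J , J∪y-ind with ∈p∪⁅x⁆⁻ {p = F} {x} y∈F∪x
  ...         | inj₁ y∈F = ⊥-elim (basis-maximal J-basis y∈F y∉J J∪y-ind)
  ...         | inj₂ refl = ⊥-elim (basis-maximal (basis-∪-cl I-basis x∈clA) (x∈p∪⁅x⁆ A x)
                              (x∉F ∘ A⊆F ∘ I⊆A) (independent-⊆ J∪y-ind (∪⁅⁆-mono I⊆J)))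

  cl-mono : ∀ {A B} → A ⊆ B → cl A ⊆ cl B
  cl-mono {B = B} A⊆B = cl-least (cl-flat B) (⊆-trans A⊆B (⊆cl B))

  flat-⊇-same-rank : ∀ {F Z} → Flat M F → F ⊆ Z → rk M Z ≤ rk M F → Z ⊆ F
  flat-⊇-same-rank {F} {Z} F-flat F⊆Z rkZ≤rkF {x} x∈Z with x ∈? F
  ... | yes x∈F = x∈F
  ... | no x∉F = contradiction (≤-trans (rk-mono (∪⁅⁆-⊆ F⊆Z x∈Z)) rkZ≤rkF) (<⇒≱ (flat⇒rank-jump F-flat x∉F))

  circuit? : ∀ C → Dec (Circuit M C)
  circuit? C = (indep M C Bool.≟ false) ×-dec all? (λ x → x ∈? C →-dec (indep M (C - x) Bool.≟ true))

  circuit-within : ∀ {A} → Dependent A → ∃ λ D → Circuit M D × D ⊆ A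
  circuit-within {A} = shrink (suc ∣ A ∣) ≤-refl
    where
    shrink : ∀ k {A} → ∣ A ∣ < k → Dependent A → ∃ λ D → Circuit M D × D ⊆ A
    shrink (suc k) {A} ∣A∣<k A-dep with any? (λ x → x ∈? A ×-dec (indep M (A - x) Bool.≟ false))
    ... | no none = A , (A-dep , λ x x∈A → Bool.¬-not λ A-x-dep → none (x , x∈A , A-x-dep)) , ⊆-refl
    ... | yes (x , x∈A , A-x-dep) with shrink k (<-≤-trans (x∈p⇒∣p-x∣<∣p∣ x∈A) (≤-pred ∣A∣<k)) A-x-dep
    ...   | D , D-circ , D⊆A-x = D , D-circ , ⊆-trans D⊆A-x (p─q⊆p A ⁅ x ⁆)

  fundamental-circuit : ∀ {I x} → Independent I → Dependent (I ∪ ⁅ x ⁆) →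
                        ∃ λ D → Circuit M D × D ⊆ I ∪ ⁅ x ⁆ × x ∈ D
  fundamental-circuit {I} {x} I-ind I∪x-dep with circuit-within I∪x-dep
  ... | D , D-circ@(D-dep , _) , D⊆I∪x with x ∈? D
  ...   | yes x∈D = D , D-circ , D⊆I∪x , x∈D
  ...   | no x∉D = ⊥-elim (independent⇒¬dependent (independent-⊆ I-ind D⊆I) D-dep)
    where
    D⊆I : D ⊆ I
    D⊆I y∈D with ∈p∪⁅x⁆⁻ {p = I} {x} (D⊆I∪x y∈D)
    ... | inj₁ y∈I = y∈I
    ... | inj₂ refl = contradiction y∈D x∉D

  dependent-nonempty : ∀ {A} → Dependent A → Nonempty A
  dependent-nonempty {A} A-dep with nonempty? A
  ... | yes A-nonempty = A-nonempty
  ... | no A-empty = ⊥-elim (independent⇒¬dependent (independent-⊆ (indep-empty M) A⊆⊥) A-dep)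
    where
    A⊆⊥ : A ⊆ ⊥
    A⊆⊥ x∈A = contradiction (_ , x∈A) A-empty

  loopfree⇒circuit-rank-pos : Loopfree M → ∀ {D} → Circuit M D → 1 ≤ rk M D
  loopfree⇒circuit-rank-pos loopfree (D-dep , _) with dependent-nonempty D-dep
  ... | x , x∈D = subst (_≤ _) (∣⁅x⁆∣≡1 x) (independent⇒≤rk (loopfree x) (x∈p⇒⁅x⁆⊆p x∈D))

  -- For a circuit D, x ∈ cl D outside D and y ∈ D, the set (D - y) ∪ {x} is
  -- dependent: it has |D| elements but lies in D ∪ {x}, of rank rk D < |D|.
  circuit-exchange : ∀ {D x y} → Circuit M D → x ∈ cl D → x ∉ D → y ∈ D → Dependent ((D - y) ∪ ⁅ x ⁆)
  circuit-exchange {D} {x} {y} (D-dep , _) x∈clD x∉D y∈D with independent? ((D - y) ∪ ⁅ x ⁆)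
  ... | inj₂ exchanged-dep = exchanged-dep
  ... | inj₁ exchanged-ind = ⊥-elim (<⇒≱ (dependent⇒rk<∣∣ D-dep) (begin
    ∣ D ∣                    ≡⟨ x∈p⇒∣p∣≡1+∣p-x∣ y∈D ⟩
    suc ∣ D - y ∣            ≡⟨ sym (x∉p⇒∣p∪⁅x⁆∣≡1+∣p∣ (D - y) (x∉D ∘ p─q⊆p D ⁅ y ⁆)) ⟩
    ∣ (D - y) ∪ ⁅ x ⁆ ∣      ≤⟨ independent⇒≤rk exchanged-ind (∪⁅⁆-mono (p─q⊆p D ⁅ y ⁆)) ⟩
    rk M (D ∪ ⁅ x ⁆)         ≤⟨ ∈cl⁻ {D} x∈clD ⟩
    rk M D                   ∎))
    where open ≤-Reasoning

  -- The closure of a circuit is cyclic: an element x ∈ cl D outside D lies on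
  -- the fundamental circuit of (D - y) ∪ {x} for any y ∈ D.
  cl-circuit-cyclic : ∀ {D} → Circuit M D → Cyclic M (cl D)
  cl-circuit-cyclic {D} D-circ x x∈clD with x ∈? D
  ... | yes x∈D = D , D-circ , ⊆cl D , x∈D
  ... | no x∉D with dependent-nonempty (proj₁ D-circ)
  ...   | y , y∈D with fundamental-circuit (proj₂ D-circ y y∈D) (circuit-exchange D-circ x∈clD x∉D y∈D)
  ...     | E , E-circ , E⊆D-y∪x , x∈E =
    E , E-circ , ⊆-trans E⊆D-y∪x (∪⁅⁆-⊆ (⊆-trans (p─q⊆p D ⁅ y ⁆) (⊆cl D)) x∈clD) , x∈E

  cl-circuit-cyclicFlat : ∀ {D} → Circuit M D → CyclicFlat M (cl D)
  cl-circuit-cyclicFlat {D} D-circ = cl-flat D , cl-circuit-cyclic D-circ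

positive-index : ∀ {k r} → 1 ≤ k → k ≤ r → ∃ λ (i : Fin r) → suc (toℕ i) ≡ k
positive-index {suc k} _ k<r = fromℕ< k<r , cong suc (toℕ-fromℕ< k<r)

-- The chain of a nested matroid M of rank r: starting from cl ∅, repeatedly
-- adjoin an element lying in every cyclic flat not yet covered and close.
module NestedChain {n : ℕ} (M : Matroid n) (nested : Nested M) (r : ℕ) (rank≡r : rank M ≡ r) where
  open MatroidTheory M

  rk≤r : ∀ A → rk M A ≤ r
  rk≤r A = subst (rk M A ≤_) rank≡r (rk-mono {A} {⊤} ⊆⊤)

  -- Cyclic flats of circuits are totally ordered, hence ordered by size.
  smaller-cyclic-flat-⊆ : ∀ {D E} → Circuit M D → Circuit M E → ∣ cl D ∣ ≤ ∣ cl E ∣ → cl D ⊆ cl E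
  smaller-cyclic-flat-⊆ {D} {E} D-circ E-circ ∣clD∣≤∣clE∣
    with nested (cl D) (cl E) (cl-circuit-cyclicFlat D-circ) (cl-circuit-cyclicFlat E-circ)
  ... | inj₁ clD⊆clE = clD⊆clE
  ... | inj₂ clE⊆clD = ⊆-by-size clE⊆clD ∣clD∣≤∣clE∣

  Escapes : Subset n → Subset n → Set
  Escapes F D = Circuit M D × ¬ (cl D ⊆ F)

  escapes? : ∀ F D → Dec (Escapes F D)
  escapes? F D = circuit? D ×-dec ¬? (cl D ⊆? F)

  inside-or-escapes : ∀ F D → Circuit M D → cl D ⊆ F ⊎ Escapes F D
  inside-or-escapes F D D-circ with cl D ⊆? F
  ... | yes clD⊆F = inj₁ clD⊆F
  ... | no clD⊈F = inj₂ (D-circ , clD⊈F)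

  smallest-escaping : ∀ {F} D₀ Ds → (∀ {D} → Escapes F D → D ∈ˡ D₀ ∷ Ds) → (∀ {D} → D ∈ˡ D₀ ∷ Ds → Escapes F D) →
                      ∃ λ m → Escapes F m × (∀ {D} → Escapes F D → ∣ cl m ∣ ≤ ∣ cl D ∣)
  smallest-escaping D₀ Ds complete sound =
    argmin (∣_∣ ∘ cl) D₀ Ds , argmin-all (∣_∣ ∘ cl) (sound (here refl)) (All.tabulate (sound ∘ there)) ,
    λ D-escapes → smallest (complete D-escapes)
    where
    smallest : ∀ {D} → D ∈ˡ D₀ ∷ Ds → ∣ cl (argmin (∣_∣ ∘ cl) D₀ Ds) ∣ ≤ ∣ cl D ∣
    smallest (here refl) = f[argmin]≤f[⊤] {f = ∣_∣ ∘ cl} D₀ Ds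
    smallest (there D∈Ds) = All.lookup (f[argmin]≤f[xs] {f = ∣_∣ ∘ cl} D₀ Ds) D∈Ds

  -- There is an element outside F lying in every cyclic flat that escapes F:
  -- any element of a smallest escaping cyclic flat that is not in F.
  common-new-element : ∀ {F} → ∃ (λ y → y ∉ F) → ∃ λ x → x ∉ F × (∀ D → Circuit M D → cl D ⊆ F ⊎ x ∈ cl D)
  common-new-element {F} (y , y∉F) = from-list (filter (escapes? F) (allSubsets n))
    (λ D-escapes → ∈-filter⁺ (escapes? F) (allSubsets-complete _) D-escapes)
    (λ D∈ → proj₂ (∈-filter⁻ (escapes? F) {xs = allSubsets n} D∈))
    where
    from-list : (Ds : List (Subset n)) → (∀ {D} → Escapes F D → D ∈ˡ Ds) → (∀ {D} → D ∈ˡ Ds → Escapes F D) →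
                ∃ λ x → x ∉ F × (∀ D → Circuit M D → cl D ⊆ F ⊎ x ∈ cl D)
    from-list [] complete _ = y , y∉F , λ D D-circ →
      map₂ (λ D-escapes → contradiction (complete D-escapes) λ ()) (inside-or-escapes F D D-circ)
    from-list (D₀ ∷ Ds) complete sound with smallest-escaping D₀ Ds complete sound
    ... | m , (m-circ , clm⊈F) , m-smallest with ⊈-witness clm⊈F
    ...   | x , x∈clm , x∉F = x , x∉F , λ D D-circ →
      map₂ (λ D-escapes → smaller-cyclic-flat-⊆ m-circ D-circ (m-smallest D-escapes) x∈clm)
                    (inside-or-escapes F D D-circ)

  Compatible : Subset n → Set
  Compatible F = ∀ D → Circuit M D → cl D ⊆ F ⊎ F ⊆ cl D

  compatible-step : ∀ {F x} → Compatible F → (∀ D → Circuit M D → cl D ⊆ F ⊎ x ∈ cl D) →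
                    Compatible (cl (F ∪ ⁅ x ⁆))
  compatible-step {F} {x} F-compat covers D D-circ with covers D D-circ | F-compat D D-circ
  ... | inj₁ clD⊆F | _          = inj₁ (⊆-trans clD⊆F (F⊆cl[F∪x] F x))
  ... | inj₂ _     | inj₁ clD⊆F = inj₁ (⊆-trans clD⊆F (F⊆cl[F∪x] F x))
  ... | inj₂ x∈clD | inj₂ F⊆clD = inj₂ (cl-least (cl-flat D) (∪⁅⁆-⊆ F⊆clD x∈clD))

  record Stage : Set where
    constructor stage
    field
      carrier    : Subset n
      flat       : Flat M carrier
      compatible : Compatible carrier
  open Stage

  grow : (S : Stage) → ∃ (λ y → y ∉ carrier S) → Stage
  grow (stage F _ F-compat) fresh with common-new-element {F} fresh
  ... | x , _ , covers = stage (cl (F ∪ ⁅ x ⁆)) (cl-flat (F ∪ ⁅ x ⁆)) (compatible-step F-compat covers)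

  grow-step : ∀ S fresh → carrier S ⊂ carrier (grow S fresh) ×
              rk M (carrier (grow S fresh)) ≡ suc (rk M (carrier S))
  grow-step (stage F F-flat _) fresh with common-new-element {F} fresh
  ... | x , x∉F , _ =
    (F⊆cl[F∪x] F x , x , ⊆cl (F ∪ ⁅ x ⁆) (x∈p∪⁅x⁆ F x) , x∉F) ,
    trans (rk-cl (F ∪ ⁅ x ⁆)) (≤-antisym (rk-∪⁅⁆ F x) (flat⇒rank-jump F-flat x∉F))

  outside-element : ∀ {F} → rk M F < r → ∃ λ y → y ∉ F
  outside-element {F} rk<r with ⊈-witness {p = ⊤} {F} (λ ⊤⊆F → <⇒≱ rk<r (subst (_≤ rk M F) rank≡r (rk-mono ⊤⊆F)))
  ... | y , _ , y∉F = y , y∉F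

  next : Stage → Stage
  next S with rk M (carrier S) <? r
  ... | yes rk<r = grow S (outside-element rk<r)
  ... | no _ = S

  next-step : ∀ S → rk M (carrier S) < r → carrier S ⊂ carrier (next S) ×
              rk M (carrier (next S)) ≡ suc (rk M (carrier S))
  next-step S rk<r with rk M (carrier S) <? r
  ... | yes rk<r' = grow-step S (outside-element rk<r')
  ... | no rk≮r = contradiction rk<r rk≮r

  -- The k-th stage F_k, starting from F₀ = cl ∅ (compatible, being contained in
  -- every closure).
  stages : ℕ → Stage
  stages zero = stage (cl ⊥) (cl-flat ⊥) λ D _ → inj₂ (cl-mono {⊥} {D} ⊥⊆)
  stages (suc k) = next (stages k)

  stages-rank : ∀ {k} → k ≤ r → rk M (carrier (stages k)) ≡ k
  stages-rank {zero} _ = trans (rk-cl ⊥) (n≤0⇒n≡0 (subst (rk M ⊥ ≤_) (∣⊥∣≡0 n) (rk≤∣∣ ⊥)))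
  stages-rank {suc k} k<r = trans (proj₂ (next-step (stages k) (subst (_< r) (sym IH) k<r))) (cong suc IH)
    where
    IH : rk M (carrier (stages k)) ≡ k
    IH = stages-rank (<⇒≤ k<r)

  stages-strict : ∀ {k} → k < r → carrier (stages k) ⊂ carrier (stages (suc k))
  stages-strict {k} k<r = proj₁ (next-step (stages k) (subst (_< r) (sym (stages-rank (<⇒≤ k<r))) k<r))

  stages-top : carrier (stages r) ≡ ⊤
  stages-top = ⊆-antisym ⊆⊤ (flat-⊇-same-rank (flat (stages r)) ⊆⊤
                                 (≤-reflexive (trans rank≡r (sym (stages-rank ≤-refl)))))

  -- Every circuit D lies in the stage of rank rk D: that stage is comparable
  -- with the flat cl D of the same rank.
  circuit-in-stage : ∀ {D} → Circuit M D → D ⊆ carrier (stages (rk M D))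
  circuit-in-stage {D} D-circ with compatible (stages (rk M D)) D D-circ
  ... | inj₁ clD⊆F = ⊆-trans (⊆cl D) clD⊆F
  ... | inj₂ F⊆clD = ⊆-trans (⊆cl D) (flat-⊇-same-rank (flat (stages (rk M D))) F⊆clD
                                        (≤-reflexive (trans (rk-cl D) (sym (stages-rank (rk≤r D))))))

  chain : Chain r n
  chain = record
    { set = λ i → carrier (stages (suc (toℕ i)))
    ; first-nonempty = λ i _ → let _ , x , x∈ , _ = stages-strict (toℕ<n i) in x , x∈
    ; strict = λ i j j≡1+i → subst (λ k → carrier (stages (suc (toℕ i))) ⊂ carrier (stages (suc k))) (sym j≡1+i)
                               (stages-strict (subst (_< r) j≡1+i (toℕ<n j)))
    ; last-top = λ i 1+i≡r → subst (λ k → carrier (stages k) ≡ ⊤) (sym 1+i≡r) stages-top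
    }

  chain-flats : ∀ i → Flat M (set chain i)
  chain-flats i = flat (stages (suc (toℕ i)))

  -- In a loopfree nested matroid, every circuit D lies in the chain member of
  -- rank rk D (the position exists since rk D ≥ 1).
  circuit-in-chain : Loopfree M → ∀ {D} → Circuit M D → ∃ λ (i : Fin r) → D ⊆ set chain i × suc (toℕ i) ≡ rk M D
  circuit-in-chain loopfree {D} D-circ with positive-index (loopfree⇒circuit-rank-pos loopfree D-circ) (rk≤r D)
  ... | i , 1+i≡rkD = i , subst (λ k → D ⊆ carrier (stages k)) (sym 1+i≡rkD) (circuit-in-stage D-circ) , 1+i≡rkD

module ChainOfFlats {n r : ℕ} (N : Matroid n) (rank≡r : rank N ≡ r) (C : Chain r n)
                    (C-flats : ∀ i → Flat N (set C i)) where
  open MatroidTheory N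
  open ≤-Reasoning hiding (strict)

  rank-increases : ∀ i j → toℕ j ≡ suc (toℕ i) → suc (rk N (set C i)) ≤ rk N (set C j)
  rank-increases i j j≡1+i with strict C i j j≡1+i
  ... | Ci⊆Cj , x , x∈Cj , x∉Ci = ≤-trans (flat⇒rank-jump (C-flats i) x∉Ci) (rk-mono (∪⁅⁆-⊆ Ci⊆Cj x∈Cj))

  rank+distance≤r : ∀ m i → suc (toℕ i) + m ≡ r → rk N (set C i) + m ≤ r
  rank+distance≤r zero i i+1≡r = begin
    rk N (set C i) + 0   ≡⟨ +-identityʳ _ ⟩
    rk N (set C i)       ≡⟨ cong (rk N) (last-top C i (trans (sym (+-identityʳ _)) i+1≡r)) ⟩
    rank N               ≡⟨ rank≡r ⟩
    r                    ∎
  rank+distance≤r (suc m) i i+1+suc-m≡r = begin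
    rk N (set C i) + suc m     ≡⟨ +-suc _ m ⟩
    suc (rk N (set C i)) + m   ≤⟨ +-monoˡ-≤ m (rank-increases i j toℕ-j) ⟩
    rk N (set C j) + m         ≤⟨ rank+distance≤r m j (trans (cong (λ l → suc l + m) toℕ-j) i+2+m≡r) ⟩
    r                          ∎
    where
    i+2+m≡r : suc (suc (toℕ i)) + m ≡ r
    i+2+m≡r = trans (sym (+-suc (suc (toℕ i)) m)) i+1+suc-m≡r
    i+2≤r : suc (suc (toℕ i)) ≤ r
    i+2≤r = subst (suc (suc (toℕ i)) ≤_) i+2+m≡r (m≤m+n _ m)
    j : Fin r
    j = fromℕ< i+2≤r
    toℕ-j : toℕ j ≡ suc (toℕ i)
    toℕ-j = toℕ-fromℕ< i+2≤r

  chain-rank-bound : ∀ i → rk N (set C i) ≤ suc (toℕ i)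
  chain-rank-bound i = +-cancelʳ-≤ (r ∸ suc (toℕ i)) _ _ (begin
    rk N (set C i) + (r ∸ suc (toℕ i))   ≤⟨ rank+distance≤r _ i (m+[n∸m]≡n (toℕ<n i)) ⟩
    r                                    ≡⟨ sym (m+[n∸m]≡n (toℕ<n i)) ⟩
    suc (toℕ i) + (r ∸ suc (toℕ i))      ∎)

module _ {n r : ℕ} (M N : Matroid n) (loopfree : Loopfree M) (nested : Nested M)
         (rankM≡r : rank M ≡ r) (rankN≡r : rank N ≡ r) where
  private
    module InM = MatroidTheory M
    module InN = MatroidTheory N
  open NestedChain M nested r rankM≡r using (chain; circuit-in-chain)

  -- If the chain of M consists of flats of N, every N-independent set is
  -- M-independent: a circuit D of M lies in the member at position rk D,
  -- whose N-rank is at most rk D < |D|, so D is N-dependent.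
  independent-transfer : (∀ i → Flat N (set chain i)) → ∀ A → indep N A ≡ true → indep M A ≡ true
  independent-transfer N-flats A A-indN with InM.independent? A
  ... | inj₁ A-indM = A-indM
  ... | inj₂ A-depM with InM.circuit-within A-depM
  ...   | D , D-circ@(D-depM , _) , D⊆A with circuit-in-chain loopfree D-circ
  ...     | i , D⊆Fi , i+1≡rkD = ⊥-elim (<⇒≱ (InM.dependent⇒rk<∣∣ D-depM) (begin
    ∣ D ∣                   ≤⟨ InN.independent⇒≤rk (InN.independent-⊆ A-indN D⊆A) D⊆Fi ⟩
    rk N (set chain i)      ≤⟨ ChainOfFlats.chain-rank-bound N rankN≡r chain N-flats i ⟩
    suc (toℕ i)             ≡⟨ i+1≡rkD ⟩
    rk M D                  ∎))
    where open ≤-Reasoning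

v≡1 : ∀ {r n} (N : Matroid n) (C : Chain r n) → (∀ i → Flat N (set C i)) → v N C ≡ 1ℤ
v≡1 N C flats = cong (if_then 1ℤ else 0ℤ) (all-allFin⁺ (λ i → isFlat N (set C i)) flats)

v≢0⇒flats : ∀ {r n} (N : Matroid n) (C : Chain r n) → v N C ≢ 0ℤ → ∀ i → Flat N (set C i)
v≢0⇒flats {r} N C v≢0 with and (map (λ i → isFlat N (set C i)) (allFin r)) in all-flat
... | true = all-allFin⁻ _ all-flat
... | false = contradiction refl v≢0

countᵇ : {A : Set} → (A → Bool) → List A → ℕ
countᵇ p [] = 0
countᵇ p (a ∷ as) = if p a then suc (countᵇ p as) else countᵇ p as

countᵇ-mono : ∀ {A : Set} {p q : A → Bool} → (∀ a → p a ≡ true → q a ≡ true) →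
              ∀ as → countᵇ p as ≤ countᵇ q as
countᵇ-mono p⇒q [] = ≤-refl
countᵇ-mono {p = p} {q} p⇒q (a ∷ as) with p a in pa | q a in qa
... | true  | true  = s≤s (countᵇ-mono p⇒q as)
... | true  | false = contradiction (trans (sym (p⇒q a pa)) qa) λ ()
... | false | true  = m≤n⇒m≤1+n (countᵇ-mono p⇒q as)
... | false | false = countᵇ-mono p⇒q as

countᵇ-mono-strict : ∀ {A : Set} {p q : A → Bool} → (∀ a → p a ≡ true → q a ≡ true) →
                     ∀ {a as} → a ∈ˡ as → p a ≡ false → q a ≡ true → countᵇ p as < countᵇ q as
countᵇ-mono-strict p⇒q {as = _ ∷ as} (here refl) pa qa rewrite pa | qa = s≤s (countᵇ-mono p⇒q as)
countᵇ-mono-strict {p = p} {q} p⇒q {as = b ∷ as} (there a∈as) pa qa with p b in pb | q b in qb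
... | true  | true  = s≤s (countᵇ-mono-strict p⇒q a∈as pa qa)
... | true  | false = contradiction (trans (sym (p⇒q b pb)) qb) λ ()
... | false | true  = m≤n⇒m≤1+n (countᵇ-mono-strict p⇒q a∈as pa qa)
... | false | false = countᵇ-mono-strict p⇒q a∈as pa qa

#independent : ∀ {n} → Matroid n → ℕ
#independent {n} M = countᵇ (indep M) (allSubsets n)

#independent-< : ∀ {n} (M N : Matroid n) → (∀ A → indep N A ≡ true → indep M A ≡ true) →
                 ¬ SameMatroid N M → #independent N < #independent M
#independent-< {n} M N N⇒M N≠M with anySubset? (λ A → ¬? (indep N A Bool.≟ indep M A))
... | no never-differ =
  contradiction (λ A → decidable-stable (indep N A Bool.≟ indep M A) λ differ → never-differ (A , differ)) N≠M
... | yes (A , differ) with indep N A in NA | indep M A in MA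
... | false | true  = countᵇ-mono-strict N⇒M (allSubsets-complete A) NA MA
... | true  | false = contradiction (trans (sym (N⇒M A NA)) MA) λ ()
... | true  | true  = contradiction refl differ
... | false | false = contradiction refl differ

∑-zero : ∀ {k} (f : Fin k → ℤ) → (∀ j → f j ≡ 0ℤ) → ∑ f ≡ 0ℤ
∑-zero {zero} f _ = refl
∑-zero {suc k} f all-zero = cong₂ Int._+_ (all-zero zero) (∑-zero (f ∘ suc) (all-zero ∘ suc))

∑-single : ∀ {k} (f : Fin k → ℤ) i → (∀ j → j ≢ i → f j ≡ 0ℤ) → ∑ f ≡ f i
∑-single {suc k} f zero others-zero =
  trans (cong (Int._+_ (f zero)) (∑-zero (f ∘ suc) λ j → others-zero (suc j) λ ())) (Intₚ.+-identityʳ (f zero))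
∑-single {suc k} f (suc i) others-zero =
  trans (cong₂ Int._+_ (others-zero zero λ ()) (∑-single (f ∘ suc) i λ j j≢i → others-zero (suc j) (j≢i ∘ suc-injective)))
        (Intₚ.+-identityˡ (f (suc i)))

-- If each w i takes the value 1 at a test point t i, and w j can be nonzero
-- at t i (j ≠ i) only when μ j < μ i, then the w i are linearly independent
-- over ℤ: by well-founded induction on μ i, every other term of the relation
-- evaluated at t i vanishes, leaving c i = 0.
unitriangular⇒independent : ∀ {T : Set} {k} (w : Fin k → T → ℤ) (μ : Fin k → ℕ) (t : Fin k → T) →
  (∀ i → w i (t i) ≡ 1ℤ) → (∀ i j → j ≢ i → w j (t i) ≢ 0ℤ → μ j < μ i) →
  (c : Fin k → ℤ) → (∀ x → ∑ (λ j → c j * w j x) ≡ 0ℤ) → ∀ i → c i ≡ 0ℤ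
unitriangular⇒independent w μ t diagonal lower c relation i = vanish i (<-wellFounded (μ i))
  where
  vanish : ∀ i → Acc _<_ (μ i) → c i ≡ 0ℤ
  vanish i (acc smaller) = begin
    c i                          ≡⟨ sym (*-identityʳ (c i)) ⟩
    c i * 1ℤ                     ≡⟨ cong (c i *_) (sym (diagonal i)) ⟩
    c i * w i (t i)              ≡⟨ sym (∑-single (λ j → c j * w j (t i)) i off-diagonal) ⟩
    ∑ (λ j → c j * w j (t i))    ≡⟨ relation (t i) ⟩
    0ℤ                           ∎
    where
    open ≡-Reasoning
    off-diagonal : ∀ j → j ≢ i → c j * w j (t i) ≡ 0ℤ
    off-diagonal j j≢i with w j (t i) Int.≟ 0ℤ
    ... | yes w≡0 = trans (cong (c j *_) w≡0) (*-zeroʳ (c j))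
    ... | no w≢0 = trans (cong (_* w j (t i)) (vanish j (smaller (lower i j j≢i w≢0)))) (*-zeroˡ (w j (t i)))

-- Proposition 3.2: for the family M of distinct loopfree nested matroids, test
-- the relation on the chain of each M i and order by the number of independent
-- sets.
proposition3p2 : (r n : ℕ) → 1 ≤ r → r ≤ n →
    (k : ℕ) (M : Fin k → Matroid n) →
    (∀ i → LoopfreeNestedRank r n (M i)) →
    (∀ i j → i ≢ j → ¬ SameMatroid (M i) (M j)) →
    (c : Fin k → ℤ) →
    (∀ (C : Chain r n) → ∑ (λ i → c i * v (M i) C) ≡ 0ℤ) →
    ∀ i → c i ≡ 0ℤ
proposition3p2 r n _ _ k M hypotheses distinct c relation =
  unitriangular⇒independent (λ i → v (M i)) (λ i → #independent (M i)) chain-of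
    (λ i → v≡1 (M i) (chain-of i) (NestedChain.chain-flats (M i) (nested i) r (rank≡r i)))
    lower c relation
  where
  loopfree : ∀ i → Loopfree (M i)
  loopfree i = proj₁ (hypotheses i)
  nested : ∀ i → Nested (M i)
  nested i = proj₁ (proj₂ (hypotheses i))
  rank≡r : ∀ i → rank (M i) ≡ r
  rank≡r i = proj₂ (proj₂ (hypotheses i))

  -- The test point for M i: its compatible chain, on which v (M i) is 1.
  chain-of : Fin k → Chain r n
  chain-of i = NestedChain.chain (M i) (nested i) r (rank≡r i)

  lower : ∀ i j → j ≢ i → v (M j) (chain-of i) ≢ 0ℤ → #independent (M j) < #independent (M i)
  lower i j j≢i v≢0 = #independent-< (M i) (M j)
    (independent-transfer (M i) (M j) (loopfree i) (nested i) (rank≡r i) (rank≡r j) (v≢0⇒flats (M j) (chain-of i) v≢0))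
    (distinct j i j≢i)
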